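{- Let $r \geqslant 0$ and $k \geqslant 1$ be integers, and let $t \geqslant 2$ and $1 \leqslant n_1 \leqslant \cdots \leqslant n_t$ be integers. The complete $t$-partite graph $K_{n_1,n_2,\ldots,n_t}$ has an $r$-equitable $k$-coloring in which no color is missing if and only if there exists a positive integer $m$ such that $\lfloor n_i/m \rfloor \geqslant \lceil n_i/(m+r) \rceil$ for all $1 \leqslant i \leqslant t$ and $\sum_{i=1}^t \lfloor n_i/m \rfloor \geqslant k \geqslant \sum_{i=1}^t \lceil n_i/(m+r) \rceil$.
   Context: All graphs are finite, simple and undirected. For a positive integer $k$, a (proper) $k$-coloring of a graph $G=(V,E)$ is a map $f: V \to \{1,\ldots,k\}$ with $f(u)\neq f(v)$ whenever $uv \in E$; the color classes are the sets $\{u \in V : f(u)=c\}$ for $c=1,\ldots,k$, and these may be empty. A color is missing if its color class is empty. For an integer $r \geqslant 0$, a $k$-coloring is $r$-equitable if the sizes of any two of its $k$ color classes (including empty ones) differ by at most $r$. $K_{n_1,\ldots,n_t}$ denotes the complete $t$-partite graph whose vertex set is partitioned into independent sets $V_1,\ldots,V_t$ with $|V_i|=n_i$, every vertex of $V_i$ adjacent to every vertex of $V_j$ for $i \neq j$. -}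

module Defs where

open import Data.Nat using (ℕ; zero; suc; _+_; _∸_; _≤_; _/_; NonZero)
open import Data.Fin using (Fin; _≟_)
open import Data.Product using (Σ; _,_)
open import Data.List using (map; allFin)
open import Data.Nat.ListAction using (sum)
open import Relation.Nullary using (¬_; yes; no)
open import Relation.Binary.PropositionalEquality using (_≡_; _≢_)

⌈_/_⌉ : ℕ → (b : ℕ) → .{{NonZero b}} → ℕ
⌈ a / b ⌉ = (a + b ∸ 1) / b

∑ : (t : ℕ) → (Fin t → ℕ) → ℕ
∑ t f = sum (map f (allFin t))

count : {k : ℕ} (n : ℕ) → (Fin n → Fin k) → Fin k → ℕ
count zero    f c = 0
count (suc n) f c with f Fin.zero ≟ c
... | yes _ = suc (count n (λ j → f (Fin.suc j)) c)
... | no  _ = count n (λ j → f (Fin.suc j)) c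

-- The complete t-partite graph K_{n_1,…,n_t}: vertices are pairs (i , j)
-- with i ∈ Fin t the part and j ∈ Fin (n i) the vertex within part i.
Vertex : (t : ℕ) → (Fin t → ℕ) → Set
Vertex t n = Σ (Fin t) (λ i → Fin (n i))

Adj : (t : ℕ) (n : Fin t → ℕ) → Vertex t n → Vertex t n → Set
Adj t n (i , _) (i' , _) = i ≢ i'

IsProperColoring : (t : ℕ) (n : Fin t → ℕ) (k : ℕ) → (Vertex t n → Fin k) → Set
IsProperColoring t n k f = ∀ u v → Adj t n u v → f u ≢ f v

classSize : (t : ℕ) (n : Fin t → ℕ) (k : ℕ) → (Vertex t n → Fin k) → Fin k → ℕ
classSize t n k f c = ∑ t (λ i → count (n i) (λ j → f (i , j)) c)

IsREquitable : (t : ℕ) (n : Fin t → ℕ) (k r : ℕ) → (Vertex t n → Fin k) → Set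
IsREquitable t n k r f = ∀ c c' → classSize t n k f c ≤ classSize t n k f c' + r

NoMissingColor : (t : ℕ) (n : Fin t → ℕ) (k : ℕ) → (Vertex t n → Fin k) → Set
NoMissingColor t n k f = ∀ c → 1 ≤ classSize t n k f c

-- In a proper colouring of a complete multipartite graph every colour class lies inside a
-- single part. So an r-equitable k-colouring without missing colours, whose smallest class
-- has size m, is the same as a choice of numbers k_i with k_1 + ⋯ + k_t = k together with a
-- splitting of each part V_i into k_i classes of sizes in [m, m + r]. Such a splitting of
-- V_i exists iff k_i m ≤ n_i ≤ k_i (m + r), i.e. ⌈n_i/(m+r)⌉ ≤ k_i ≤ ⌊n_i/m⌋, and integers
-- k_i in these ranges summing to k exist iff k lies between the sums of the bounds.
module Submission where

open import Defs
open import Data.Nat using (ℕ; zero; suc; _+_; _*_; _∸_; _≤_; _<_; _/_; _%_; z≤n; s≤s; s≤s⁻¹; _≤?_; NonZero)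
open import Data.Nat.Properties
open import Data.Nat.DivMod
open import Data.Fin using (Fin; zero; suc; _↑ˡ_; _↑ʳ_; punchIn; splitAt)
import Data.Fin
import Data.Fin.Properties as Fin
open import Data.Vec.Functional using (_∷_; _++_)
open import Data.Vec.Functional.Properties using (lookup-++ˡ; lookup-++ʳ)
open import Data.Product as Product using (Σ; _,_; _×_; ∃-syntax; proj₁; proj₂)
open import Data.Sum using (inj₁; inj₂)
open import Data.Empty using (⊥-elim)
import Data.List.Base as List using (tabulate; allFin)
import Data.List.Properties as List using (map-tabulate)
import Data.Nat.ListAction as ListAction
open import Data.List.Relation.Unary.All as All using (All)
open import Data.List.Membership.Propositional.Properties using (∈-allFin)
open import Data.List.Extrema.Nat using (argmin; f[argmin]≤f[xs])
open import Algebra.Properties.Semiring.Sum +-*-semiring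
  using (sum; sum-cong-≗; sum-remove; sum-replicate-zero; ∑-comm; *-distribʳ-sum)
open import Relation.Nullary using (yes; no; decidable-stable)
open import Relation.Binary.PropositionalEquality
open import Function using (_∘_; id)
open import Function.Definitions using (Injective)
open import Function.Bundles using (_⇔_; mk⇔)

∑≡sum : ∀ t (f : Fin t → ℕ) → ∑ t f ≡ sum f
∑≡sum t f = trans (cong ListAction.sum (List.map-tabulate id f)) (listSum-tabulate f)
  where
  listSum-tabulate : ∀ {t} (g : Fin t → ℕ) → ListAction.sum (List.tabulate g) ≡ sum g
  listSum-tabulate {zero}  g = refl
  listSum-tabulate {suc t} g = cong (g zero +_) (listSum-tabulate (g ∘ suc))

sum-const : ∀ t c → sum {t} (λ _ → c) ≡ t * c
sum-const zero    c = refl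
sum-const (suc t) c = cong (c +_) (sum-const t c)

sum-mono-≤ : ∀ {t} {f g : Fin t → ℕ} → (∀ i → f i ≤ g i) → sum f ≤ sum g
sum-mono-≤ {zero}  f≤g = z≤n
sum-mono-≤ {suc t} f≤g = +-mono-≤ (f≤g zero) (sum-mono-≤ (f≤g ∘ suc))

sum-↑ : ∀ m {n} (f : Fin (m + n) → ℕ) → sum f ≡ sum (f ∘ (_↑ˡ n)) + sum (f ∘ (m ↑ʳ_))
sum-↑ zero    f = refl
sum-↑ (suc m) f = trans (cong (f zero +_) (sum-↑ m (f ∘ suc))) (sym (+-assoc (f zero) _ _))

sum-supported-at : ∀ {t} (f : Fin t → ℕ) i → (∀ j → j ≢ i → f j ≡ 0) → sum f ≡ f i
sum-supported-at {suc t} f i f≡0 = begin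
  sum f                          ≡⟨ sum-remove f ⟩
  f i + sum (f ∘ punchIn i)      ≡⟨ cong (f i +_) (sum-cong-≗ (λ j → f≡0 _ (Fin.punchInᵢ≢i i j))) ⟩
  f i + sum {t} (λ _ → 0)        ≡⟨ cong (f i +_) (sum-replicate-zero t) ⟩
  f i + 0                        ≡⟨ +-identityʳ (f i) ⟩
  f i                            ∎
  where open ≡-Reasoning

sum-pos : ∀ {t} (f : Fin t → ℕ) → 1 ≤ sum f → ∃[ i ] 1 ≤ f i
sum-pos {suc t} f 1≤∑ with f zero in f₀≡
... | suc _ = zero , subst (1 ≤_) (sym f₀≡) (s≤s z≤n)
... | zero  = let (i , 1≤fi) = sum-pos (f ∘ suc) 1≤∑ in suc i , 1≤fi

-- Keep the first entry at its lower bound while the others can still make up the rest;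
-- otherwise put the others at their upper bounds.
sum-between : ∀ {t} (lo hi : Fin t → ℕ) N → (∀ i → lo i ≤ hi i) → sum lo ≤ N → N ≤ sum hi
  → ∃[ x ] ((∀ i → lo i ≤ x i × x i ≤ hi i) × sum x ≡ N)
sum-between {zero}  lo hi N _ _ N≤0 = (λ ()) , (λ ()) , sym (n≤0⇒n≡0 N≤0)
sum-between {suc t} lo hi N lo≤hi ∑lo≤N N≤∑hi with N ≤? lo zero + sum (hi ∘ suc)
... | yes N≤ =
  let (x , x-between , ∑x) = sum-between (lo ∘ suc) (hi ∘ suc) (N ∸ lo zero) (lo≤hi ∘ suc)
        (subst (_≤ N ∸ lo zero) (m+n∸m≡n (lo zero) _) (∸-monoˡ-≤ (lo zero) ∑lo≤N))
        (m≤n+o⇒m∸n≤o N (lo zero) N≤)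
  in lo zero ∷ x
   , (λ { zero → ≤-refl , lo≤hi zero ; (suc i) → x-between i })
   , trans (cong (lo zero +_) ∑x) (m+[n∸m]≡n (m+n≤o⇒m≤o (lo zero) ∑lo≤N))
... | no N≰ =
  let ∑hi′ = sum (hi ∘ suc)
      <N = ≰⇒> N≰
  in N ∸ ∑hi′ ∷ hi ∘ suc
   , (λ { zero → m+n≤o⇒m≤o∸n (lo zero) (<⇒≤ <N)
                , subst (N ∸ ∑hi′ ≤_) (m+n∸n≡m (hi zero) ∑hi′) (∸-monoˡ-≤ ∑hi′ N≤∑hi)
        ; (suc i) → lo≤hi (suc i) , ≤-refl })
   , m∸n+n≡m (m+n≤o⇒n≤o (lo zero) (<⇒≤ <N))

*≤⇒≤/ : ∀ a N m .{{_ : NonZero m}} → a * m ≤ N → a ≤ N / m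
*≤⇒≤/ a N m am≤N = subst (_≤ N / m) (m*n/n≡m a m) (/-monoˡ-≤ m am≤N)

≤/⇒*≤ : ∀ a N m .{{_ : NonZero m}} → a ≤ N / m → a * m ≤ N
≤/⇒*≤ a N m a≤N/m = ≤-trans (*-monoˡ-≤ m a≤N/m) (m/n*n≤m N m)

⌈/⌉≡ : ∀ N q → ⌈ N / suc q ⌉ ≡ (N + q) / suc q
⌈/⌉≡ N q = cong (λ x → (x ∸ 1) / suc q) (+-suc N q)

≤*⇒⌈/⌉≤ : ∀ a N q → N ≤ a * suc q → ⌈ N / suc q ⌉ ≤ a
≤*⇒⌈/⌉≤ a N q N≤aq = subst (_≤ a) (sym (⌈/⌉≡ N q)) (s≤s⁻¹ (m<n*o⇒m/o<n N+q<))
  where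
  N+q< : N + q < suc a * suc q
  N+q< = subst (N + q <_) (+-comm (a * suc q) (suc q)) (+-mono-≤-< N≤aq (n<1+n q))

⌈/⌉≤⇒≤* : ∀ a N q → ⌈ N / suc q ⌉ ≤ a → N ≤ a * suc q
⌈/⌉≤⇒≤* a N q ⌈⌉≤a = +-cancelʳ-≤ q N (a * suc q) (begin
  N + q                                         ≡⟨ m≡m%n+[m/n]*n (N + q) (suc q) ⟩
  (N + q) % suc q + (N + q) / suc q * suc q     ≤⟨ +-mono-≤ (s≤s⁻¹ (m%n<n (N + q) (suc q)))
                                                           (*-monoˡ-≤ (suc q) (subst (_≤ a) (⌈/⌉≡ N q) ⌈⌉≤a)) ⟩
  q + a * suc q                                 ≡⟨ +-comm q (a * suc q) ⟩
  a * suc q + q                                 ∎)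
  where open ≤-Reasoning

δ : ∀ {k} → Fin k → Fin k → ℕ
δ x y with x Fin.≟ y
... | yes _ = 1
... | no  _ = 0

δ-refl : ∀ {k} (x : Fin k) → δ x x ≡ 1
δ-refl x with x Fin.≟ x
... | yes _   = refl
... | no  x≢x = ⊥-elim (x≢x refl)

δ-≢ : ∀ {k} {x y : Fin k} → x ≢ y → δ x y ≡ 0
δ-≢ {x = x} {y} x≢y with x Fin.≟ y
... | yes x≡y = ⊥-elim (x≢y x≡y)
... | no  _   = refl

δ-pos : ∀ {k} {x y : Fin k} → 1 ≤ δ x y → x ≡ y
δ-pos {x = x} {y} 1≤δ with x Fin.≟ y
... | yes x≡y = x≡y

δ-injective : ∀ {k l} {e : Fin k → Fin l} → Injective _≡_ _≡_ e → ∀ x y → δ (e x) (e y) ≡ δ x y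
δ-injective e-inj x y with x Fin.≟ y
... | yes refl = δ-refl _
... | no  x≢y  = δ-≢ (x≢y ∘ e-inj)

sum-δ : ∀ {k} (x : Fin k) → sum (δ x) ≡ 1
sum-δ x = trans (sum-supported-at (δ x) x (λ y y≢x → δ-≢ (y≢x ∘ sym))) (δ-refl x)

count≡sum-δ : ∀ {k} n (f : Fin n → Fin k) c → count n f c ≡ sum (λ j → δ (f j) c)
count≡sum-δ zero    f c = refl
count≡sum-δ (suc n) f c with f zero Fin.≟ c
... | yes _ = cong suc (count≡sum-δ n (f ∘ suc) c)
... | no  _ = count≡sum-δ n (f ∘ suc) c

sum-count : ∀ {k} n (f : Fin n → Fin k) → sum (count n f) ≡ n
sum-count {k} n f = begin
  sum (count n f)                      ≡⟨ sum-cong-≗ (count≡sum-δ n f) ⟩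
  sum {k} (λ c → sum (λ j → δ (f j) c)) ≡⟨ ∑-comm (λ c j → δ (f j) c) ⟩
  sum {n} (λ j → sum (δ (f j)))        ≡⟨ sum-cong-≗ (sum-δ ∘ f) ⟩
  sum {n} (λ _ → 1)                    ≡⟨ sum-const n 1 ⟩
  n * 1                                ≡⟨ *-identityʳ n ⟩
  n                                    ∎
  where open ≡-Reasoning

count-pos : ∀ {k} n (f : Fin n → Fin k) c → 1 ≤ count n f c → ∃[ j ] f j ≡ c
count-pos n f c 1≤count =
  let (j , 1≤δ) = sum-pos _ (subst (1 ≤_) (count≡sum-δ n f c) 1≤count) in j , δ-pos 1≤δ

count-∉ : ∀ {k} n (f : Fin n → Fin k) c → (∀ j → f j ≢ c) → count n f c ≡ 0
count-∉ n f c f≢c = trans (count≡sum-δ n f c) (trans (sum-cong-≗ (λ j → δ-≢ (f≢c j))) (sum-replicate-zero n))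

count-∘-injective : ∀ {k l} n (f : Fin n → Fin k) {e : Fin k → Fin l} → Injective _≡_ _≡_ e
  → ∀ c → count n (e ∘ f) (e c) ≡ count n f c
count-∘-injective n f {e} e-inj c = begin
  count n (e ∘ f) (e c)          ≡⟨ count≡sum-δ n _ _ ⟩
  sum (λ j → δ (e (f j)) (e c))  ≡⟨ sum-cong-≗ (λ j → δ-injective e-inj (f j) c) ⟩
  sum (λ j → δ (f j) c)          ≡⟨ count≡sum-δ n f c ⟨
  count n f c                    ∎
  where open ≡-Reasoning

count-cong : ∀ {k} n {f g : Fin n → Fin k} → (∀ j → f j ≡ g j) → ∀ c → count n f c ≡ count n g c
count-cong n {f} {g} f≗g c = begin
  count n f c            ≡⟨ count≡sum-δ n f c ⟩
  sum (λ j → δ (f j) c)  ≡⟨ sum-cong-≗ (λ j → cong (λ x → δ x c) (f≗g j)) ⟩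
  sum (λ j → δ (g j) c)  ≡⟨ count≡sum-δ n g c ⟨
  count n g c            ∎
  where open ≡-Reasoning

count-↑ : ∀ {k} m {n} (f : Fin (m + n) → Fin k) c
  → count (m + n) f c ≡ count m (f ∘ (_↑ˡ n)) c + count n (f ∘ (m ↑ʳ_)) c
count-↑ m {n} f c = begin
  count (m + n) f c                                            ≡⟨ count≡sum-δ (m + n) f c ⟩
  sum (λ j → δ (f j) c)                                        ≡⟨ sum-↑ m _ ⟩
  sum (λ j → δ (f (j ↑ˡ n)) c) + sum (λ j → δ (f (m ↑ʳ j)) c)
    ≡⟨ cong₂ _+_ (count≡sum-δ m _ c) (count≡sum-δ n _ c) ⟨
  count m (f ∘ (_↑ˡ n)) c + count n (f ∘ (m ↑ʳ_)) c            ∎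
  where open ≡-Reasoning

count-const : ∀ {k} n (x : Fin k) → count n (λ _ → x) x ≡ n
count-const n x = begin
  count n (λ _ → x) x   ≡⟨ count≡sum-δ n _ x ⟩
  sum {n} (λ _ → δ x x) ≡⟨ sum-cong-≗ {n} (λ _ → δ-refl x) ⟩
  sum {n} (λ _ → 1)     ≡⟨ sum-const n 1 ⟩
  n * 1                 ≡⟨ *-identityʳ n ⟩
  n                     ∎
  where open ≡-Reasoning

-- Fin (sum κ) listed block by block: κ 0 indices for 0, then κ 1 indices for 1, and so on.
flatten : ∀ {t} (κ : Fin t → ℕ) → Σ (Fin t) (Fin ∘ κ) → Fin (sum κ)
flatten κ (zero  , x) = x ↑ˡ sum (κ ∘ suc)
flatten κ (suc i , x) = κ zero ↑ʳ flatten (κ ∘ suc) (i , x)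

unflatten : ∀ {t} (κ : Fin t → ℕ) → Fin (sum κ) → Σ (Fin t) (Fin ∘ κ)
unflatten {suc t} κ = (zero ,_) ++ (Product.map suc id ∘ unflatten (κ ∘ suc))

unflatten-↑ˡ : ∀ {t} (κ : Fin (suc t) → ℕ) x → unflatten κ (x ↑ˡ sum (κ ∘ suc)) ≡ (zero , x)
unflatten-↑ˡ κ = lookup-++ˡ (zero ,_) (Product.map suc id ∘ unflatten (κ ∘ suc))

unflatten-↑ʳ : ∀ {t} (κ : Fin (suc t) → ℕ) c
  → unflatten κ (κ zero ↑ʳ c) ≡ Product.map suc id (unflatten (κ ∘ suc) c)
unflatten-↑ʳ κ = lookup-++ʳ (zero ,_) (Product.map suc id ∘ unflatten (κ ∘ suc))

unflatten-flatten : ∀ {t} (κ : Fin t → ℕ) p → unflatten κ (flatten κ p) ≡ p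
unflatten-flatten κ (zero  , x) = unflatten-↑ˡ κ x
unflatten-flatten κ (suc i , x) =
  trans (unflatten-↑ʳ κ _) (cong (Product.map suc id) (unflatten-flatten (κ ∘ suc) (i , x)))

flatten-unflatten : ∀ {t} (κ : Fin t → ℕ) c → flatten κ (unflatten κ c) ≡ c
flatten-unflatten {suc t} κ c with splitAt (κ zero) c in split≡
... | inj₁ x = Fin.splitAt⁻¹-↑ˡ split≡
... | inj₂ c′ = trans (cong (κ zero ↑ʳ_) (flatten-unflatten (κ ∘ suc) c′)) (Fin.splitAt⁻¹-↑ʳ split≡)

flatten-injective : ∀ {t} (κ : Fin t → ℕ) → Injective _≡_ _≡_ (flatten κ)
flatten-injective κ {p} {q} same =
  trans (sym (unflatten-flatten κ p)) (trans (cong (unflatten κ) same) (unflatten-flatten κ q))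

flatten-injectiveʳ : ∀ {t} (κ : Fin t → ℕ) i → Injective _≡_ _≡_ (λ x → flatten κ (i , x))
flatten-injectiveʳ κ zero    same = Fin.↑ˡ-injective _ _ _ same
flatten-injectiveʳ κ (suc i) same = flatten-injectiveʳ (κ ∘ suc) i (Fin.↑ʳ-injective _ _ _ same)

count-unflatten : ∀ {K} (p : Fin K → ℕ) c → count (sum p) (proj₁ ∘ unflatten p) c ≡ p c
count-unflatten {suc K} p c = begin
  count (p zero + sum p′) (proj₁ ∘ unflatten p) c
    ≡⟨ count-↑ (p zero) _ c ⟩
  count (p zero) (proj₁ ∘ unflatten p ∘ (_↑ˡ sum p′)) c + count (sum p′) (proj₁ ∘ unflatten p ∘ (p zero ↑ʳ_)) c
    ≡⟨ cong₂ _+_ (count-cong (p zero) (cong proj₁ ∘ unflatten-↑ˡ p) c)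
                 (count-cong (sum p′) (cong proj₁ ∘ unflatten-↑ʳ p) c) ⟩
  count (p zero) (λ _ → zero) c + count (sum p′) (suc ∘ proj₁ ∘ unflatten p′) c
    ≡⟨ blocks c ⟩
  p c ∎
  where
  open ≡-Reasoning
  p′ = p ∘ suc
  blocks : ∀ c → count (p zero) (λ _ → zero) c + count (sum p′) (suc ∘ proj₁ ∘ unflatten p′) c ≡ p c
  blocks zero    = trans (cong₂ _+_ (count-const (p zero) zero)
                                    (count-∉ (sum p′) (suc ∘ proj₁ ∘ unflatten p′) zero (λ _ ())))
                         (+-identityʳ (p zero))
  blocks (suc c) = cong₂ _+_ (count-∉ (p zero) _ (suc c) (λ _ ()))
                             (trans (count-∘-injective (sum p′) _ Fin.suc-injective c) (count-unflatten p′ c))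

prescribed-fibres : ∀ {K} N (p : Fin K → ℕ) → sum p ≡ N → Σ (Fin N → Fin K) λ h → ∀ c → count N h c ≡ p c
prescribed-fibres _ p refl = proj₁ ∘ unflatten p , count-unflatten p

fibres-between : ∀ {a b} K N → a ≤ b → K * a ≤ N → N ≤ K * b
  → Σ (Fin N → Fin K) λ h → ∀ c → a ≤ count N h c × count N h c ≤ b
fibres-between {a} {b} K N a≤b Ka≤N N≤Kb =
  let (p , p-between , ∑p≡N) = sum-between (λ _ → a) (λ _ → b) N (λ _ → a≤b)
                                  (subst (_≤ N) (sym (sum-const K a)) Ka≤N)
                                  (subst (N ≤_) (sym (sum-const K b)) N≤Kb)
      (h , count≡p) = prescribed-fibres N p ∑p≡N
  in h , λ c → subst (λ s → a ≤ s × s ≤ b) (sym (count≡p c)) (p-between c)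

ClassSizesBetween : (t : ℕ) (n : Fin t → ℕ) (k : ℕ) → (Vertex t n → Fin k) → ℕ → ℕ → Set
ClassSizesBetween t n k f a b = ∀ c → a ≤ classSize t n k f c × classSize t n k f c ≤ b

-- The minimal class size is m = suc m′.
Admissible : (r k t : ℕ) → (Fin t → ℕ) → ℕ → Set
Admissible r k t n m′ = (∀ i → ⌈ n i / (suc m′ + r) ⌉ ≤ n i / suc m′)
                      × (∑ t (λ i → ⌈ n i / (suc m′ + r) ⌉) ≤ k)
                      × (k ≤ ∑ t (λ i → n i / suc m′))

module Amalgamation {t} (n κ : Fin t → ℕ) (g : ∀ i → Fin (n i) → Fin (κ i)) where

  colouring : Vertex t n → Fin (sum κ)
  colouring (i , j) = flatten κ (i , g i j)

  colouring-proper : IsProperColoring t n (sum κ) colouring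
  colouring-proper _ _ i≢i′ same = i≢i′ (cong proj₁ (flatten-injective κ same))

  classSize-flatten : ∀ i x → classSize t n (sum κ) colouring (flatten κ (i , x)) ≡ count (n i) (g i) x
  classSize-flatten i x = begin
    classSize t n (sum κ) colouring (flatten κ (i , x))
      ≡⟨ ∑≡sum t _ ⟩
    sum (λ i′ → count (n i′) (λ j → colouring (i′ , j)) (flatten κ (i , x)))
      ≡⟨ sum-supported-at _ i (λ i′ i′≢i → count-∉ (n i′) _ _ λ _ same →
                                 i′≢i (cong proj₁ (flatten-injective κ same))) ⟩
    count (n i) (λ j → flatten κ (i , g i j)) (flatten κ (i , x))
      ≡⟨ count-∘-injective (n i) (g i) (flatten-injectiveʳ κ i) x ⟩
    count (n i) (g i) x
      ∎
    where open ≡-Reasoning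

  colouring-between : ∀ {a b} → (∀ i x → a ≤ count (n i) (g i) x × count (n i) (g i) x ≤ b)
    → ClassSizesBetween t n (sum κ) colouring a b
  colouring-between {a} {b} between c =
    subst (λ c → a ≤ classSize t n (sum κ) colouring c × classSize t n (sum κ) colouring c ≤ b)
          (flatten-unflatten κ c)
          (subst (λ s → a ≤ s × s ≤ b) (sym (classSize-flatten i x)) (between i x))
    where
    i = proj₁ (unflatten κ c)
    x = proj₂ (unflatten κ c)

admissible⇒colouring : ∀ r k t (n : Fin t → ℕ) m′ → Admissible r k t n m′
  → ∃[ f ] (IsProperColoring t n k f × ClassSizesBetween t n k f (suc m′) (suc m′ + r))
admissible⇒colouring r k t n m′ (lo≤hi , ∑lo≤k , k≤∑hi)
  with sum-between (λ i → ⌈ n i / (suc m′ + r) ⌉) (λ i → n i / suc m′) k lo≤hi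
         (subst (_≤ k) (∑≡sum t _) ∑lo≤k) (subst (k ≤_) (∑≡sum t _) k≤∑hi)
... | κ , κ-between , refl = colouring , colouring-proper , colouring-between (proj₂ ∘ part)
  where
  part : ∀ i → Σ (Fin (n i) → Fin (κ i)) λ h → ∀ c → suc m′ ≤ count (n i) h c × count (n i) h c ≤ suc m′ + r
  part i = fibres-between (κ i) (n i) (m≤m+n (suc m′) r)
             (≤/⇒*≤ (κ i) (n i) (suc m′) (proj₂ (κ-between i)))
             (⌈/⌉≤⇒≤* (κ i) (n i) (m′ + r) (proj₁ (κ-between i)))
  open Amalgamation n κ (proj₁ ∘ part)

module ColourParts {t n k} {f : Vertex t n → Fin k}
  (proper : IsProperColoring t n k f) (complete : NoMissingColor t n k f) where

  partCount : Fin t → Fin k → ℕ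
  partCount i = count (n i) (λ j → f (i , j))

  same-part : ∀ {i i′ c} → 1 ≤ partCount i c → 1 ≤ partCount i′ c → i ≡ i′
  same-part {i} {i′} {c} in-i in-i′ = decidable-stable (i Fin.≟ i′) λ i≢i′ →
    let (j , fij≡c) = count-pos (n i) _ c in-i
        (j′ , fi′j′≡c) = count-pos (n i′) _ c in-i′
    in proper (i , j) (i′ , j′) i≢i′ (trans fij≡c (sym fi′j′≡c))

  occupied : ∀ c → ∃[ i ] 1 ≤ partCount i c
  occupied c = sum-pos (λ i → partCount i c) (subst (1 ≤_) (∑≡sum t _) (complete c))

  home : Fin k → Fin t
  home = proj₁ ∘ occupied

  partCount-home : ∀ c → 1 ≤ partCount (home c) c
  partCount-home = proj₂ ∘ occupied

  partCount-away : ∀ {i c} → i ≢ home c → partCount i c ≡ 0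
  partCount-away {i} {c} i≢home = n<1⇒n≡0 (≰⇒> λ in-i → i≢home (same-part in-i (partCount-home c)))

  partCount≡ : ∀ i c → partCount i c ≡ δ (home c) i * classSize t n k f c
  -- The with also evaluates δ (home c) i, leaving the goals … ≡ 1 * … and … ≡ 0 * … .
  partCount≡ i c with home c Fin.≟ i
  ... | yes refl = begin
    partCount (home c) c
      ≡⟨ sum-supported-at (λ i′ → partCount i′ c) (home c) (λ _ → partCount-away) ⟨
    sum (λ i′ → partCount i′ c)                ≡⟨ ∑≡sum t _ ⟨
    classSize t n k f c                        ≡⟨ *-identityˡ _ ⟨
    1 * classSize t n k f c                    ∎
    where open ≡-Reasoning
  ... | no home≢i = partCount-away (home≢i ∘ sym)

  colours-in-part : ∀ {a b} → ClassSizesBetween t n k f a b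
    → ∀ i → count k home i * a ≤ n i × n i ≤ count k home i * b
  colours-in-part {a} {b} between i =
      subst₂ _≤_ (sym (scaled a)) (sym n≡) (sum-mono-≤ λ c → *-monoʳ-≤ (δ (home c) i) (proj₁ (between c)))
    , subst₂ _≤_ (sym n≡) (sym (scaled b)) (sum-mono-≤ λ c → *-monoʳ-≤ (δ (home c) i) (proj₂ (between c)))
    where
    n≡ : n i ≡ sum (λ c → δ (home c) i * classSize t n k f c)
    n≡ = trans (sym (sum-count (n i) (λ j → f (i , j)))) (sum-cong-≗ {k} (partCount≡ i))
    scaled : ∀ x → count k home i * x ≡ sum (λ c → δ (home c) i * x)
    scaled x = trans (cong (_* x) (count≡sum-δ k home i)) (*-distribʳ-sum x (λ c → δ (home c) i))

between⇒admissible : ∀ r k t (n : Fin t → ℕ) m′ {f : Vertex t n → Fin k} → IsProperColoring t n k f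
  → ClassSizesBetween t n k f (suc m′) (suc m′ + r) → Admissible r k t n m′
between⇒admissible r k t n m′ proper between =
    (λ i → ≤-trans (lo≤κ i) (κ≤hi i))
  , subst₂ _≤_ (sym (∑≡sum t _)) (sum-count k home) (sum-mono-≤ lo≤κ)
  , subst₂ _≤_ (sum-count k home) (sym (∑≡sum t _)) (sum-mono-≤ κ≤hi)
  where
  open ColourParts proper (λ c → ≤-trans (s≤s z≤n) (proj₁ (between c)))
  lo≤κ : ∀ i → ⌈ n i / (suc m′ + r) ⌉ ≤ count k home i
  lo≤κ i = ≤*⇒⌈/⌉≤ (count k home i) (n i) (m′ + r) (proj₂ (colours-in-part between i))
  κ≤hi : ∀ i → count k home i ≤ n i / suc m′
  κ≤hi i = *≤⇒≤/ (count k home i) (n i) (suc m′) (proj₁ (colours-in-part between i))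

equitable⇒between : ∀ r k t (n : Fin t → ℕ) {f : Vertex t n → Fin k} → 1 ≤ k
  → IsREquitable t n k r f → NoMissingColor t n k f
  → ∃[ m′ ] ClassSizesBetween t n k f (suc m′) (suc m′ + r)
equitable⇒between r (suc k) t n {f} _ equitable complete =
  size c₀ ∸ 1 , λ c → subst (λ m → m ≤ size c × size c ≤ m + r) (sym (m+[n∸m]≡n (complete c₀)))
                            (All.lookup minimal (∈-allFin c) , equitable c c₀)
  where
  size = classSize t n (suc k) f
  c₀ = argmin size zero (List.allFin (suc k))
  minimal : All (λ c → size c₀ ≤ size c) (List.allFin (suc k))
  minimal = f[argmin]≤f[xs] zero (List.allFin (suc k))

between⇒equitable : ∀ r k t (n : Fin t → ℕ) m′ {f : Vertex t n → Fin k}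
  → ClassSizesBetween t n k f (suc m′) (suc m′ + r) → IsREquitable t n k r f × NoMissingColor t n k f
between⇒equitable r k t n m′ between =
    (λ c c′ → ≤-trans (proj₂ (between c)) (+-monoˡ-≤ r (proj₁ (between c′))))
  , (λ c → ≤-trans (s≤s z≤n) (proj₁ (between c)))

lemma9 : (r k t : ℕ) → (n : Fin t → ℕ) → 1 ≤ k → 2 ≤ t
    → (∀ i → 1 ≤ n i)
    → (∀ i j → i Data.Fin.≤ j → n i ≤ n j)
    → (∃[ f ] (IsProperColoring t n k f × IsREquitable t n k r f × NoMissingColor t n k f))
      ⇔ (∃[ m' ] ((∀ i → ⌈ n i / (suc m' + r) ⌉ ≤ n i / suc m')
                 × (∑ t (λ i → ⌈ n i / (suc m' + r) ⌉) ≤ k)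
                 × (k ≤ ∑ t (λ i → n i / suc m'))))
lemma9 r k t n 1≤k _ _ _ = mk⇔
  (λ (f , proper , equitable , complete) →
     let (m′ , between) = equitable⇒between r k t n 1≤k equitable complete
     in m′ , between⇒admissible r k t n m′ proper between)
  (λ (m′ , admissible) →
     let (f , proper , between) = admissible⇒colouring r k t n m′ admissible
     in f , proper , between⇒equitable r k t n m′ between)
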